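{- Let $G$ be a connected chordal claw-free graph with clique tree $T_G=(\mathcal M,\mathcal E)$. If a max clique $B\in\mathcal M$ has a fork triangle, then $B$ is a fork clique.
   Context: Graphs are finite simple undirected. A graph is chordal if every cycle of length at least 4 has a chord, and claw-free if it has no induced $K_{1,3}$. A max clique is an inclusion-maximal clique; $\mathcal M$ is the set of max cliques and $\mathcal M_v$ the set of max cliques containing $v$. A clique tree is a tree on $\mathcal M$ in which each $T[\mathcal M_v]$ is connected; a connected chordal claw-free graph has exactly one clique tree $T_G$, and each $T_G[\mathcal M_v]$ is a path. Max cliques $A_1,A_2,A_3$ form a fork triangle around $B$ if they are distinct neighbours of $B$ in $T_G$ and there are vertices $u,v,w$ with $\mathcal M_u=\{A_1,B,A_2\}$, $\mathcal M_v=\{A_2,B,A_3\}$, $\mathcal M_w=\{A_3,B,A_1\}$. A max clique $B$ of degree 3 in $T_G$ is a fork clique if (i) for every $v\in B$ there are two distinct neighbours $A,A'$ of $B$ with $\mathcal M_v=\{B,A,A'\}$, and (ii) for all distinct neighbours $A,A'$ of $B$ there is $v\in B$ with $\mathcal M_v=\{B,A,A'\}$. -}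

module Defs where

open import Level using (0ℓ)
open import Data.Nat using (ℕ; suc; _≤_)
open import Data.Fin using (Fin; toℕ)
open import Data.Fin.Subset using (Subset; _∈_; _⊆_)
open import Data.Product using (Σ; ∃; _×_; _,_)
open import Data.Sum using (_⊎_)
open import Data.Unit using (⊤)
open import Data.Empty using (⊥)
open import Relation.Nullary using (¬_)
open import Relation.Binary.PropositionalEquality using (_≡_; _≢_)

record Graph (n : ℕ) : Set₁ where
  field
    Adj     : Fin n → Fin n → Set
    sym     : ∀ {u v} → Adj u v → Adj v u
    irrefl  : ∀ {u} → ¬ Adj u u

open Graph public

module _ {n : ℕ} (G : Graph n) where

  data WalkIn (P : Fin n → Set) : Fin n → Fin n → Set where
    stop : ∀ {u} → P u → WalkIn P u u
    step : ∀ {u v w} → P u → Adj G u v → WalkIn P v w → WalkIn P u w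

  InducedConnected : (Fin n → Set) → Set
  InducedConnected P = ∀ u v → P u → P v → WalkIn P u v

  Connected : Set
  Connected = InducedConnected (λ _ → ⊤)

  CycNext : ∀ {k} → Fin k → Fin k → Set
  CycNext {k} i j = (suc (toℕ i) ≡ toℕ j) ⊎ ((suc (toℕ i) ≡ k) × (toℕ j ≡ 0))

  IsCycle : ∀ {k} → (Fin k → Fin n) → Set
  IsCycle {k} c = (3 ≤ k)
                × (∀ i j → c i ≡ c j → i ≡ j)
                × (∀ i j → CycNext i j → Adj G (c i) (c j))

  HasChord : ∀ {k} → (Fin k → Fin n) → Set
  HasChord {k} c = Σ (Fin k) λ i → Σ (Fin k) λ j →
    (i ≢ j) × ¬ CycNext i j × ¬ CycNext j i × Adj G (c i) (c j)

  Chordal : Set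
  Chordal = ∀ k (c : Fin k → Fin n) → 4 ≤ k → IsCycle c → HasChord c

  Acyclic : Set
  Acyclic = ∀ k (c : Fin k → Fin n) → ¬ IsCycle c

  IsTree : Set
  IsTree = Connected × Acyclic

  ClawFree : Set
  ClawFree = ∀ c x y z → Adj G c x → Adj G c y → Adj G c z →
             x ≢ y → y ≢ z → x ≢ z →
             ¬ Adj G x y → ¬ Adj G y z → ¬ Adj G x z → ⊥

  IsClique : Subset n → Set
  IsClique S = ∀ u v → u ∈ S → v ∈ S → u ≢ v → Adj G u v

  IsMaxClique : Subset n → Set
  IsMaxClique S = IsClique S × (∀ S′ → IsClique S′ → S ⊆ S′ → S′ ⊆ S)

-- Clique trees.  The set 𝓜 of max cliques is enumerated injectively and
-- exhaustively by K : Fin m → Subset n; the tree T lives on Fin m.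

record CliqueTree {n : ℕ} (G : Graph n) : Set₁ where
  field
    m       : ℕ
    K       : Fin m → Subset n
    K-max   : ∀ i → IsMaxClique G (K i)
    K-onto  : ∀ S → IsMaxClique G S → ∃ λ i → K i ≡ S
    K-inj   : ∀ i j → K i ≡ K j → i ≡ j
    T       : Graph m
    T-tree  : IsTree T
    T-sub   : ∀ v → InducedConnected T (λ i → v ∈ K i)

open CliqueTree public

module _ {n : ℕ} {G : Graph n} (CT : CliqueTree G) where

  private
    I = Fin (m CT)

  -- 𝓜_v = {a, b, c}
  MEq : Fin n → I → I → I → Set
  MEq v a b c = (∀ i → v ∈ K CT i → (i ≡ a ⊎ i ≡ b ⊎ i ≡ c))
              × (v ∈ K CT a) × (v ∈ K CT b) × (v ∈ K CT c)

  Nbr : I → I → Set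
  Nbr B A = Adj (T CT) B A

  ForkTriangle : I → I → I → I → Set
  ForkTriangle B A₁ A₂ A₃ =
    Nbr B A₁ × Nbr B A₂ × Nbr B A₃ ×
    A₁ ≢ A₂ × A₂ ≢ A₃ × A₁ ≢ A₃ ×
    (∃ λ u → MEq u A₁ B A₂) ×
    (∃ λ v → MEq v A₂ B A₃) ×
    (∃ λ w → MEq w A₃ B A₁)

  HasForkTriangle : I → Set
  HasForkTriangle B = Σ I λ A₁ → Σ I λ A₂ → Σ I λ A₃ → ForkTriangle B A₁ A₂ A₃

  Degree3 : I → Set
  Degree3 B = Σ I λ A₁ → Σ I λ A₂ → Σ I λ A₃ →
    Nbr B A₁ × Nbr B A₂ × Nbr B A₃ ×
    A₁ ≢ A₂ × A₂ ≢ A₃ × A₁ ≢ A₃ ×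
    (∀ A → Nbr B A → A ≡ A₁ ⊎ A ≡ A₂ ⊎ A ≡ A₃)

  IsForkClique : I → Set
  IsForkClique B =
    Degree3 B ×
    (∀ v → v ∈ K CT B → Σ I λ A → Σ I λ A′ →
        Nbr B A × Nbr B A′ × A ≢ A′ × MEq v B A A′) ×
    (∀ A A′ → Nbr B A → Nbr B A′ → A ≢ A′ →
        ∃ λ v → v ∈ K CT B × MEq v B A A′)

-- Fix a max clique B of the clique tree T.  Removing B splits T into branches, one per
-- neighbour A of B.  Since T[𝓜_z] is connected, the cliques of a vertex z ∉ B all lie in
-- one branch, and a vertex of B lying in a clique of the branch at A also lies in A.
-- Hence vertices outside B in different branches are non-adjacent, and every claw-free
-- argument below is a claw centred at a vertex of B whose leaves sit in distinct branches:
--   * no vertex of B lies in three neighbours of B;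
--   * if some y ∈ B lies in neighbours P and Q, every vertex of B lies in P or Q;
--   * a vertex of B ∩ P ∩ Q reaches no deeper clique of the branch at P, provided some
--     y ∈ B has 𝓜_y = {P, B, S} for a third neighbour S.
-- With a fork triangle A₁, A₂, A₃ these show: every vertex of B lies in two of the Aᵢ; B has
-- no fourth neighbour (in a connected graph, adjacent cliques of T intersect); and a vertex
-- of B ∩ Aᵢ ∩ Aⱼ lies in no other max clique.  The fork-triangle vertices witness the pairs.

module Submission where

open import Defs
open import Data.Nat using (ℕ; zero; suc; _≤_; s≤s; z≤n)
open import Data.Nat.Properties using (suc-injective)
open import Data.Fin using (Fin; zero; suc; toℕ; _≟_)
open import Data.List using (List; []; _∷_; length; lookup; allFin)
open import Data.List.Relation.Unary.All as All using (All; []; _∷_)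
open import Data.List.Relation.Unary.All.Properties using (¬Any⇒All¬)
open import Data.List.Relation.Unary.AllPairs using ([]; _∷_)
open import Data.List.Relation.Unary.Unique.Propositional using (Unique)
open import Data.List.Relation.Unary.Any using (here; there)
open import Data.Fin.Subset using (Subset; _∈_; _⊆_; _∪_; ⁅_⁆)
open import Data.Fin.Subset.Properties using (_∈?_; x∈p∪q⁻; x∈p∪q⁺; x∈⁅x⁆; x∈⁅y⁆⇒x≡y; ⊆-antisym; p⊆p∪q)
open import Data.Fin.Properties using (all?; any?)
open import Data.List.Membership.Propositional using () renaming (_∈_ to _∈ₗ_)
open import Data.List.Membership.Propositional.Properties using (∈-allFin; ∈-lookup)
open import Data.Product using (Σ; ∃; _×_; _,_; proj₁; proj₂)
open import Data.Sum using (_⊎_; inj₁; inj₂)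
open import Data.Empty using (⊥; ⊥-elim)
open import Data.Unit using (tt)
open import Function using (_∘_)
open import Relation.Nullary using (¬_; Dec; yes; no; ¬?)
open import Relation.Nullary.Decidable using (_×-dec_; _→-dec_; ¬¬-excluded-middle; decidable-stable)
open import Relation.Binary.PropositionalEquality
  using (_≡_; _≢_; refl; cong; subst; trans; ≢-sym) renaming (sym to ≡-sym)

module Walks {k : ℕ} (H : Graph k) where

  open import Data.List.Membership.DecPropositional (_≟_ {k}) using () renaming (_∈?_ to _∈ₗ?_)

  walk-start : ∀ {P x y} → WalkIn H P x y → P x
  walk-start (stop p)     = p
  walk-start (step p _ _) = p

  walk-end : ∀ {P x y} → WalkIn H P x y → P y
  walk-end (stop p)     = p
  walk-end (step _ _ w) = walk-end w

  _++ʷ_ : ∀ {P x y z} → WalkIn H P x y → WalkIn H P y z → WalkIn H P x z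
  stop _     ++ʷ w′ = w′
  step p a w ++ʷ w′ = step p a (w ++ʷ w′)

  reverse : ∀ {P x y} → WalkIn H P x y → WalkIn H P y x
  reverse (stop p)     = stop p
  reverse (step p a w) = reverse w ++ʷ step (walk-start w) (Graph.sym H a) (stop p)

  weaken : ∀ {P Q : Fin k → Set} {x y} → (∀ {z} → P z → Q z) → WalkIn H P x y → WalkIn H Q x y
  weaken f (stop p)     = stop (f p)
  weaken f (step p a w) = step (f p) a (weaken f w)

  last-visit : ∀ {Q b x d} → WalkIn H Q x d → d ≢ b →
               WalkIn H (λ i → Q i × i ≢ b) x d ⊎
               Σ (Fin k) λ a → Adj H b a × WalkIn H (λ i → Q i × i ≢ b) a d
  last-visit (stop q) d≢b = inj₁ (stop (q , d≢b))
  last-visit {b = b} (step {x} q x~y w) d≢b with last-visit w d≢b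
  ... | inj₂ later = inj₂ later
  ... | inj₁ avoiding with x ≟ b
  ...   | yes refl = inj₂ (_ , x~y , avoiding)
  ...   | no  x≢b  = inj₁ (step (q , x≢b) x~y avoiding)

  vertices : ∀ {P x y} → WalkIn H P x y → List (Fin k)
  vertices {x = x} (stop _)     = x ∷ []
  vertices {x = x} (step _ _ w) = x ∷ vertices w

  vertices-in : ∀ {P x y} (w : WalkIn H P x y) → All P (vertices w)
  vertices-in (stop p)     = p ∷ []
  vertices-in (step p _ w) = p ∷ vertices-in w

  vertices-nonempty : ∀ {P x y} (w : WalkIn H P x y) → 1 ≤ length (vertices w)
  vertices-nonempty (stop _)     = s≤s z≤n
  vertices-nonempty (step _ _ _) = s≤s z≤n

  vertices-linked : ∀ {P x y} (w : WalkIn H P x y) (i j : Fin (length (vertices w))) →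
                    suc (toℕ i) ≡ toℕ j → Adj H (lookup (vertices w) i) (lookup (vertices w) j)
  vertices-linked (step _ a (stop _))     zero    (suc zero) refl = a
  vertices-linked (step _ a (step _ _ _)) zero    (suc zero) refl = a
  vertices-linked (step _ _ w)            (suc i) (suc j)    eq   = vertices-linked w i j (suc-injective eq)
  vertices-linked (stop _)                zero    zero       ()

  vertices-last : ∀ {P x y} (w : WalkIn H P x y) (i : Fin (length (vertices w))) →
                  suc (toℕ i) ≡ length (vertices w) → lookup (vertices w) i ≡ y
  vertices-last (stop _)               zero    refl = refl
  vertices-last (step _ _ w)           (suc i) eq   = vertices-last w i (suc-injective eq)
  vertices-last (step _ _ (stop _))    zero    ()
  vertices-last (step _ _ (step _ _ _)) zero   ()

  lookup-injective : ∀ {xs : List (Fin k)} → Unique xs → ∀ i j → lookup xs i ≡ lookup xs j → i ≡ j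
  lookup-injective (_  ∷ _) zero    zero    _  = refl
  lookup-injective (x∉ ∷ _) zero    (suc j) eq = ⊥-elim (All.lookup x∉ (∈-lookup j) eq)
  lookup-injective (x∉ ∷ _) (suc i) zero    eq = ⊥-elim (All.lookup x∉ (∈-lookup i) (≡-sym eq))
  lookup-injective (_  ∷ u) (suc i) (suc j) eq = cong suc (lookup-injective u i j eq)

  SimpleWalk : (Fin k → Set) → Fin k → Fin k → Set
  SimpleWalk P x y = Σ (WalkIn H P x y) λ w → Unique (vertices w)

  private
    suffix-from : ∀ {P a x y} (w : WalkIn H P x y) → Unique (vertices w) →
                  a ∈ₗ vertices w → SimpleWalk P a y
    suffix-from w@(stop _)     u       (here refl) = w , u
    suffix-from w@(step _ _ _) u       (here refl) = w , u
    suffix-from (step _ _ w)   (_ ∷ u) (there a∈) = suffix-from w u a∈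

  shortcut : ∀ {P x y} → WalkIn H P x y → SimpleWalk P x y
  shortcut (stop p) = stop p , [] ∷ []
  shortcut {x = x} (step p a w) with shortcut w
  ... | w′ , u with x ∈ₗ? vertices w′
  ...   | yes x∈ = suffix-from w′ u x∈
  ...   | no  x∉ = step p a w′ , ¬Any⇒All¬ (vertices w′) x∉ ∷ u

  -- In a forest, two distinct neighbours of b can only be joined through b:
  -- otherwise b followed by a simple bypass would be a cycle.
  no-bypass : Acyclic H → ∀ {b a c} → Adj H b a → Adj H b c → a ≢ c →
              ¬ WalkIn H (_≢ b) a c
  no-bypass acyclic {b} b~a b~c a≢c bypass with shortcut bypass
  ... | stop _ , _ = a≢c refl
  ... | w@(step _ _ rest) , unique =
    acyclic (length cycle) (lookup cycle) (s≤s (s≤s (vertices-nonempty rest)) , lookup-injective cycle-unique , closed)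
    where
      cycle : List (Fin k)
      cycle = b ∷ vertices w

      cycle-unique : Unique cycle
      cycle-unique = All.map ≢-sym (vertices-in w) ∷ unique

      closed : ∀ i j → CycNext H i j → Adj H (lookup cycle i) (lookup cycle j)
      closed zero    (suc zero) (inj₁ refl) = b~a
      closed (suc i) (suc j)    (inj₁ eq)   = vertices-linked w i j (suc-injective eq)
      closed (suc i) zero (inj₂ (eq , _)) =
        subst (λ v → Adj H v b) (≡-sym (vertices-last w i (suc-injective eq))) (Graph.sym H b~c)

¬¬-∀-Fin : ∀ {k} {P : Fin k → Set} → (∀ i → ¬ ¬ P i) → ¬ ¬ (∀ i → P i)
¬¬-∀-Fin {zero}      _    ¬all = ¬all (λ ())
¬¬-∀-Fin {suc k} {P} ¬¬P  ¬all =
  ¬¬P zero λ P₀ → ¬¬-∀-Fin (λ i → ¬¬P (suc i)) λ P₊ → ¬all λ { zero → P₀ ; (suc i) → P₊ i }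

module MaxCliques {n : ℕ} (G : Graph n) where

  DecidableAdjacency : Set
  DecidableAdjacency = ∀ x y → Dec (Adj G x y)

  ¬¬-decidable-adjacency : ¬ ¬ DecidableAdjacency
  ¬¬-decidable-adjacency = ¬¬-∀-Fin λ x → ¬¬-∀-Fin λ y → ¬¬-excluded-middle

  private-vertex : ∀ {S S′} → IsMaxClique G S → IsClique G S′ → S ≢ S′ →
                   ∃ λ a → a ∈ S × ¬ a ∈ S′
  private-vertex {S} {S′} (_ , maximal) S′-clique S≢S′
    with any? (λ a → (a ∈? S) ×-dec ¬? (a ∈? S′))
  ... | yes witness = witness
  ... | no  none    = ⊥-elim (S≢S′ (⊆-antisym S⊆S′ (maximal S′ S′-clique S⊆S′)))
    where
      S⊆S′ : S ⊆ S′
      S⊆S′ {a} a∈S with a ∈? S′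
      ... | yes a∈S′ = a∈S′
      ... | no  a∉S′ = ⊥-elim (none (a , a∈S , a∉S′))

  Addable : Subset n → Fin n → Set
  Addable S t = ∀ s → s ∈ S → s ≢ t → Adj G s t

  singleton-clique : ∀ x → IsClique G ⁅ x ⁆
  singleton-clique x u v u∈ v∈ u≢v = ⊥-elim (u≢v (trans (x∈⁅y⁆⇒x≡y x u∈) (≡-sym (x∈⁅y⁆⇒x≡y x v∈))))

  clique-add : ∀ {S t} → IsClique G S → Addable S t → IsClique G (S ∪ ⁅ t ⁆)
  clique-add {S} {t} S-clique t-addable u v u∈ v∈ u≢v
    with x∈p∪q⁻ S ⁅ t ⁆ u∈ | x∈p∪q⁻ S ⁅ t ⁆ v∈
  ... | inj₁ u∈S | inj₁ v∈S = S-clique u v u∈S v∈S u≢v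
  ... | inj₁ u∈S | inj₂ v∈t with x∈⁅y⁆⇒x≡y t v∈t
  ...   | refl = t-addable u u∈S u≢v
  clique-add {S} {t} S-clique t-addable u v u∈ v∈ u≢v
      | inj₂ u∈t | inj₁ v∈S with x∈⁅y⁆⇒x≡y t u∈t
  ...   | refl = Graph.sym G (t-addable v v∈S (≢-sym u≢v))
  clique-add {S} {t} S-clique t-addable u v u∈ v∈ u≢v
      | inj₂ u∈t | inj₂ v∈t = ⊥-elim (u≢v (trans (x∈⁅y⁆⇒x≡y t u∈t) (≡-sym (x∈⁅y⁆⇒x≡y t v∈t))))

  module Greedy (adj? : DecidableAdjacency) where

    addable? : ∀ S t → Dec (Addable S t)
    addable? S t = all? λ s → (s ∈? S) →-dec (¬? (s ≟ t) →-dec adj? s t)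

    add : (S : Subset n) (t : Fin n) → Dec (Addable S t) → Subset n
    add S t (yes _) = S ∪ ⁅ t ⁆
    add S t (no  _) = S

    grow : Subset n → List (Fin n) → Subset n
    grow S []       = S
    grow S (t ∷ ts) = grow (add S t (addable? S t)) ts

    add-clique : ∀ S t d → IsClique G S → IsClique G (add S t d)
    add-clique S t (yes t-addable) S-clique = clique-add S-clique t-addable
    add-clique S t (no  _)         S-clique = S-clique

    add-⊇ : ∀ S t d → S ⊆ add S t d
    add-⊇ S t (yes _) = p⊆p∪q ⁅ t ⁆
    add-⊇ S t (no  _) = λ s∈ → s∈

    grow-clique : ∀ S ts → IsClique G S → IsClique G (grow S ts)
    grow-clique S []       S-clique = S-clique
    grow-clique S (t ∷ ts) S-clique = grow-clique _ ts (add-clique S t (addable? S t) S-clique)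

    grow-⊇ : ∀ S ts → S ⊆ grow S ts
    grow-⊇ S []       s∈ = s∈
    grow-⊇ S (t ∷ ts) s∈ = grow-⊇ _ ts (add-⊇ S t (addable? S t) s∈)

    grow-decides : ∀ S ts {t} → t ∈ₗ ts →
                   t ∈ grow S ts ⊎ Σ (Subset n) λ S′ → S′ ⊆ grow S ts × ¬ Addable S′ t
    grow-decides S (t ∷ ts) (here refl) with addable? S t
    ... | yes _           = inj₁ (grow-⊇ _ ts (x∈p∪q⁺ (inj₂ (x∈⁅x⁆ t))))
    ... | no  t-rejected  = inj₂ (S , grow-⊇ S ts , t-rejected)
    grow-decides S (t ∷ ts) (there t∈) = grow-decides _ ts t∈

    grow-maximal : ∀ S ts → (∀ t → t ∈ₗ ts) → IsClique G S → IsMaxClique G (grow S ts)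
    grow-maximal S ts complete S-clique = grow-clique S ts S-clique , maximal
      where
        maximal : ∀ S′ → IsClique G S′ → grow S ts ⊆ S′ → S′ ⊆ grow S ts
        maximal S′ S′-clique grown⊆S′ {t} t∈S′ with grow-decides S ts (complete t)
        ... | inj₁ t∈grown = t∈grown
        ... | inj₂ (R , R⊆grown , t-rejected) =
          ⊥-elim (t-rejected λ s s∈R s≢t → S′-clique s t (grown⊆S′ (R⊆grown s∈R)) t∈S′ s≢t)

  edge-in-max-clique : ∀ {x y} → Adj G x y →
                       ¬ ¬ (Σ (Subset n) λ S → IsMaxClique G S × x ∈ S × y ∈ S)
  edge-in-max-clique {x} {y} x~y none = ¬¬-decidable-adjacency λ adj? → none (extend adj?)
    where
      pair : Subset n
      pair = ⁅ x ⁆ ∪ ⁅ y ⁆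

      y-addable : Addable ⁅ x ⁆ y
      y-addable s s∈ _ = subst (λ s → Adj G s y) (≡-sym (x∈⁅y⁆⇒x≡y x s∈)) x~y

      extend : DecidableAdjacency → Σ (Subset n) λ S → IsMaxClique G S × x ∈ S × y ∈ S
      extend adj? = grow pair (allFin n)
                  , grow-maximal pair (allFin n) ∈-allFin (clique-add (singleton-clique x) y-addable)
                  , grow-⊇ pair (allFin n) (x∈p∪q⁺ (inj₁ (x∈⁅x⁆ x)))
                  , grow-⊇ pair (allFin n) (x∈p∪q⁺ (inj₂ (x∈⁅x⁆ y)))
        where open Greedy adj?

module Symmetries {n : ℕ} {G : Graph n} (CT : CliqueTree G) where

  meq-swap₁₂ : ∀ {v a b c} → MEq CT v a b c → MEq CT v b a c
  meq-swap₁₂ (cliques , v∈a , v∈b , v∈c) = (λ i v∈i → swap (cliques i v∈i)) , v∈b , v∈a , v∈c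
    where
      swap : ∀ {i a b c : Fin (m CT)} → i ≡ a ⊎ i ≡ b ⊎ i ≡ c → i ≡ b ⊎ i ≡ a ⊎ i ≡ c
      swap (inj₁ i≡a)        = inj₂ (inj₁ i≡a)
      swap (inj₂ (inj₁ i≡b)) = inj₁ i≡b
      swap (inj₂ (inj₂ i≡c)) = inj₂ (inj₂ i≡c)

  meq-swap₂₃ : ∀ {v a b c} → MEq CT v a b c → MEq CT v a c b
  meq-swap₂₃ (cliques , v∈a , v∈b , v∈c) = (λ i v∈i → swap (cliques i v∈i)) , v∈a , v∈c , v∈b
    where
      swap : ∀ {i a b c : Fin (m CT)} → i ≡ a ⊎ i ≡ b ⊎ i ≡ c → i ≡ a ⊎ i ≡ c ⊎ i ≡ b
      swap (inj₁ i≡a)        = inj₁ i≡a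
      swap (inj₂ (inj₁ i≡b)) = inj₂ (inj₂ i≡b)
      swap (inj₂ (inj₂ i≡c)) = inj₂ (inj₁ i≡c)

  meq-swap₁₃ : ∀ {v a b c} → MEq CT v a b c → MEq CT v c b a
  meq-swap₁₃ = meq-swap₁₂ ∘ meq-swap₂₃ ∘ meq-swap₁₂

  rotate : ∀ {B A₁ A₂ A₃} → ForkTriangle CT B A₁ A₂ A₃ → ForkTriangle CT B A₂ A₃ A₁
  rotate (B~A₁ , B~A₂ , B~A₃ , A₁≢A₂ , A₂≢A₃ , A₁≢A₃ , u , v , w) =
    B~A₂ , B~A₃ , B~A₁ , A₂≢A₃ , ≢-sym A₁≢A₃ , ≢-sym A₁≢A₂ , v , w , u

module AroundClique {n : ℕ} {G : Graph n} (CT : CliqueTree G) (B : Fin (m CT)) where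

  open Walks (T CT)
  open MaxCliques G using (private-vertex; edge-in-max-clique)

  Node : Set
  Node = Fin (m CT)

  _∈K_ : Fin n → Node → Set
  x ∈K i = x ∈ K CT i

  clique-adjacent : ∀ {x y i} → x ∈K i → y ∈K i → x ≢ y → Adj G x y
  clique-adjacent {x} {y} {i} x∈ y∈ = proj₁ (K-max CT i) x y x∈ y∈

  separated : ∀ {a x i} → ¬ a ∈K i → x ∈K i → a ≢ x
  separated a∉ x∈ refl = a∉ x∈

  node-private-vertex : ∀ {i j} → i ≢ j → ∃ λ a → a ∈K i × ¬ a ∈K j
  node-private-vertex {i} {j} i≢j =
    private-vertex (K-max CT i) (proj₁ (K-max CT j)) (λ Ki≡Kj → i≢j (K-inj CT i j Ki≡Kj))

  edge-clique : ∀ {x y} → Adj G x y → ¬ ¬ (Σ Node λ E → x ∈K E × y ∈K E)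
  edge-clique x~y none = edge-in-max-clique x~y λ { (S , S-max , x∈ , y∈) →
    let (E , KE≡S) = K-onto CT S S-max
    in none (E , subst (_ ∈_) (≡-sym KE≡S) x∈ , subst (_ ∈_) (≡-sym KE≡S) y∈) }

  neighbour-≢ : ∀ {A} → Nbr CT B A → A ≢ B
  neighbour-≢ B~A refl = Graph.irrefl (T CT) B~A

  Branch : Node → Node → Set
  Branch A D = WalkIn (T CT) (_≢ B) A D

  branch-refl : ∀ {A} → Nbr CT B A → Branch A A
  branch-refl B~A = stop (neighbour-≢ B~A)

  B∉branch : ∀ {A} → ¬ Branch A B
  B∉branch A⋯B = walk-end A⋯B refl

  branch-of-neighbour : ∀ {A C} → Nbr CT B A → Nbr CT B C → Branch A C → A ≡ C
  branch-of-neighbour {A} {C} B~A B~C A⋯C with A ≟ C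
  ... | yes A≡C = A≡C
  ... | no  A≢C = ⊥-elim (no-bypass (proj₂ (T-tree CT)) B~A B~C A≢C A⋯C)

  branch-unique : ∀ {A C D} → Nbr CT B A → Nbr CT B C → Branch A D → Branch C D → A ≡ C
  branch-unique B~A B~C A⋯D C⋯D = branch-of-neighbour B~A B~C (A⋯D ++ʷ reverse C⋯D)

  -- a vertex outside B has all its cliques in one branch, since T[𝓜_z] is connected
  spread : ∀ {z A D E} → ¬ z ∈K B → z ∈K D → Branch A D → z ∈K E → Branch A E
  spread {z} z∉B z∈D A⋯D z∈E =
    A⋯D ++ʷ weaken (λ z∈i i≡B → z∉B (subst (z ∈K_) i≡B z∈i)) (T-sub CT z _ _ z∈D z∈E)

  exit-neighbour : ∀ {x D} → x ∈K B → x ∈K D → D ≢ B →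
                   Σ Node λ A → Nbr CT B A × x ∈K A × Branch A D
  exit-neighbour {x} x∈B x∈D D≢B with last-visit (T-sub CT x B _ x∈B x∈D) D≢B
  ... | inj₁ avoiding           = ⊥-elim (proj₂ (walk-start avoiding) refl)
  ... | inj₂ (A , B~A , A⋯D) = A , B~A , proj₁ (walk-start A⋯D) , weaken proj₂ A⋯D

  B-vertex-in-branch : ∀ {x A D} → Nbr CT B A → x ∈K B → x ∈K D → Branch A D → x ∈K A
  B-vertex-in-branch {x} B~A x∈B x∈D A⋯D with exit-neighbour x∈B x∈D (walk-end A⋯D)
  ... | A′ , B~A′ , x∈A′ , A′⋯D =
    subst (x ∈K_) (branch-unique B~A′ B~A A′⋯D A⋯D) x∈A′

  Beyond : Node → Fin n → Set
  Beyond A a = ¬ a ∈K B × Σ Node λ D → Branch A D × a ∈K D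

  outer-vertex : ∀ {A} → Nbr CT B A → ∃ λ a → a ∈K A × Beyond A a
  outer-vertex B~A with node-private-vertex (neighbour-≢ B~A)
  ... | a , a∈A , a∉B = a , a∈A , a∉B , _ , branch-refl B~A , a∈A

  beyond-spread : ∀ {a A E} → Beyond A a → a ∈K E → Branch A E
  beyond-spread (a∉B , D , A⋯D , a∈D) = spread a∉B a∈D A⋯D

  beyond-unique : ∀ {a A C} → Nbr CT B A → Nbr CT B C → Beyond A a → Beyond C a → A ≡ C
  beyond-unique B~A B~C (_ , D , A⋯D , a∈D) beyond-C =
    branch-unique B~A B~C A⋯D (beyond-spread beyond-C a∈D)

  beyond-adjacent : ∀ {a c A C} → Nbr CT B A → Nbr CT B C → Beyond A a → Beyond C c →
                    Adj G a c → A ≡ C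
  beyond-adjacent {A = A} {C} B~A B~C beyond-a beyond-c a~c =
    decidable-stable (A ≟ C) λ A≢C → edge-clique a~c λ { (E , a∈E , c∈E) →
      A≢C (branch-unique B~A B~C (beyond-spread beyond-a a∈E) (beyond-spread beyond-c c∈E)) }

  B-vertex-adjacent : ∀ {x a A} → Nbr CT B A → x ∈K B → Beyond A a → Adj G x a → x ∈K A
  B-vertex-adjacent {x} {A = A} B~A x∈B beyond-a x~a =
    decidable-stable (x ∈? K CT A) λ x∉A → edge-clique x~a λ { (E , x∈E , a∈E) →
      x∉A (B-vertex-in-branch B~A x∈B x∈E (beyond-spread beyond-a a∈E)) }

  -- In a connected graph, B meets each of its neighbours: a walk from beyond A
  -- into B must enter B from beyond A, and then its entry vertex lies in A.
  neighbour-meets-B : Connected G → ∀ {A} → Nbr CT B A → ∃ λ x → x ∈K B × x ∈K A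
  neighbour-meets-B connected {A} B~A =
    decidable-stable (any? λ x → (x ∈? K CT B) ×-dec (x ∈? K CT A)) λ disjoint →
      let (a , _ , beyond-a) = outer-vertex B~A
          (z , z∈B , _)      = node-private-vertex (≢-sym (neighbour-≢ B~A))
      in escape disjoint beyond-a (connected a z tt tt) z∈B
    where
      escape : ∀ {P y z} → ¬ (∃ λ x → x ∈K B × x ∈K A) → Beyond A y → WalkIn G P y z → ¬ z ∈K B
      escape _        (y∉B , _) (stop _)         = y∉B
      escape disjoint beyond-y  (step {v = y′} _ y~y′ w) with y′ ∈? K CT B
      ... | yes y′∈B = ⊥-elim (disjoint (y′ , y′∈B , B-vertex-adjacent B~A y′∈B beyond-y (Graph.sym G y~y′)))
      ... | no  y′∉B = λ z∈B → edge-clique y~y′ λ { (E , y∈E , y′∈E) →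
              escape disjoint (y′∉B , E , beyond-spread beyond-y y∈E , y′∈E) w z∈B }

  beyond-distinct : ∀ {a c A C} → Nbr CT B A → Nbr CT B C → A ≢ C →
                    Beyond A a → Beyond C c → a ≢ c
  beyond-distinct B~A B~C A≢C beyond-a beyond-c refl = A≢C (beyond-unique B~A B~C beyond-a beyond-c)

  beyond-nonadjacent : ∀ {a c A C} → Nbr CT B A → Nbr CT B C → A ≢ C →
                       Beyond A a → Beyond C c → ¬ Adj G a c
  beyond-nonadjacent B~A B~C A≢C beyond-a beyond-c a~c =
    A≢C (beyond-adjacent B~A B~C beyond-a beyond-c a~c)

  module ClawFreeAround (claw-free : ClawFree G) where

    -- no vertex of B lies in three neighbours of B (claw: x with one outer vertex of each)
    no-three-neighbours : ∀ {x P Q R} → Nbr CT B P → Nbr CT B Q → Nbr CT B R →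
                          P ≢ Q → Q ≢ R → P ≢ R →
                          x ∈K B → x ∈K P → x ∈K Q → x ∈K R → ⊥
    no-three-neighbours B~P B~Q B~R P≢Q Q≢R P≢R x∈B x∈P x∈Q x∈R
      with outer-vertex B~P | outer-vertex B~Q | outer-vertex B~R
    ... | p , p∈P , beyond-p | q , q∈Q , beyond-q | r , r∈R , beyond-r =
      claw-free _ p q r
        (clique-adjacent x∈P p∈P (≢-sym (separated (proj₁ beyond-p) x∈B)))
        (clique-adjacent x∈Q q∈Q (≢-sym (separated (proj₁ beyond-q) x∈B)))
        (clique-adjacent x∈R r∈R (≢-sym (separated (proj₁ beyond-r) x∈B)))
        (beyond-distinct B~P B~Q P≢Q beyond-p beyond-q)
        (beyond-distinct B~Q B~R Q≢R beyond-q beyond-r)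
        (beyond-distinct B~P B~R P≢R beyond-p beyond-r)
        (beyond-nonadjacent B~P B~Q P≢Q beyond-p beyond-q)
        (beyond-nonadjacent B~Q B~R Q≢R beyond-q beyond-r)
        (beyond-nonadjacent B~P B~R P≢R beyond-p beyond-r)

    -- if y ∈ B lies in neighbours P and Q, every vertex of B lies in P or Q
    -- (claw: y with outer vertices of P and Q and a vertex x of B outside both)
    pair-covers-B : ∀ {y P Q} → Nbr CT B P → Nbr CT B Q → P ≢ Q →
                    y ∈K B → y ∈K P → y ∈K Q → ∀ {x} → x ∈K B → x ∈K P ⊎ x ∈K Q
    pair-covers-B {y} {P} {Q} B~P B~Q P≢Q y∈B y∈P y∈Q {x} x∈B
      with x ∈? K CT P | x ∈? K CT Q | outer-vertex B~P | outer-vertex B~Q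
    ... | yes x∈P | _       | _ | _ = inj₁ x∈P
    ... | no  _   | yes x∈Q | _ | _ = inj₂ x∈Q
    ... | no  x∉P | no  x∉Q | p , p∈P , beyond-p | q , q∈Q , beyond-q =
      ⊥-elim (claw-free y p q x
        (clique-adjacent y∈P p∈P (≢-sym (separated (proj₁ beyond-p) y∈B)))
        (clique-adjacent y∈Q q∈Q (≢-sym (separated (proj₁ beyond-q) y∈B)))
        (clique-adjacent y∈B x∈B (≢-sym (separated x∉P y∈P)))
        (beyond-distinct B~P B~Q P≢Q beyond-p beyond-q)
        (separated (proj₁ beyond-q) x∈B)
        (separated (proj₁ beyond-p) x∈B)
        (beyond-nonadjacent B~P B~Q P≢Q beyond-p beyond-q)
        (λ q~x → x∉Q (B-vertex-adjacent B~Q x∈B beyond-q (Graph.sym G q~x)))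
        (λ p~x → x∉P (B-vertex-adjacent B~P x∈B beyond-p (Graph.sym G p~x))))

    -- Let 𝓜_y = {P, B, S}. A vertex x ∈ B ∩ P ∩ Q, for a third neighbour Q, lies in no
    -- clique D ≠ P of the branch at P (claw: x with y, an outer vertex of Q and a vertex of D ∖ P).
    not-deeper : ∀ {x y P Q S D} → Nbr CT B P → Nbr CT B Q → Nbr CT B S →
                 P ≢ Q → S ≢ P → S ≢ Q → MEq CT y P B S →
                 x ∈K B → x ∈K P → x ∈K Q → x ∈K D → Branch P D → D ≢ P → ⊥
    not-deeper {x} {y} {P} {Q} {S} {D} B~P B~Q B~S P≢Q S≢P S≢Q (y-cliques , _ , y∈B , _)
               x∈B x∈P x∈Q x∈D P⋯D D≢P
      with node-private-vertex D≢P | outer-vertex B~Q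
    ... | d , d∈D , d∉P | q , q∈Q , beyond-q =
      claw-free x d q y
        (clique-adjacent x∈D d∈D (≢-sym (separated d∉B x∈B)))
        (clique-adjacent x∈Q q∈Q (≢-sym (separated (proj₁ beyond-q) x∈B)))
        (clique-adjacent x∈B y∈B (≢-sym (separated y∉Q x∈Q)))
        (beyond-distinct B~P B~Q P≢Q beyond-d beyond-q)
        (separated (proj₁ beyond-q) y∈B)
        (separated d∉B y∈B)
        (beyond-nonadjacent B~P B~Q P≢Q beyond-d beyond-q)
        q≁y d≁y
      where
        d∉B : ¬ d ∈K B
        d∉B d∈B = d∉P (B-vertex-in-branch B~P d∈B d∈D P⋯D)

        beyond-d : Beyond P d
        beyond-d = d∉B , D , P⋯D , d∈D

        y∉Q : ¬ y ∈K Q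
        y∉Q y∈Q with y-cliques Q y∈Q
        ... | inj₁ Q≡P        = P≢Q (≡-sym Q≡P)
        ... | inj₂ (inj₁ Q≡B) = neighbour-≢ B~Q Q≡B
        ... | inj₂ (inj₂ Q≡S) = S≢Q (≡-sym Q≡S)

        q≁y : ¬ Adj G q y
        q≁y q~y = edge-clique q~y λ { (E , q∈E , y∈E) → case-E E (beyond-spread beyond-q q∈E) (y-cliques E y∈E) }
          where
            case-E : ∀ E → Branch Q E → E ≡ P ⊎ E ≡ B ⊎ E ≡ S → ⊥
            case-E _ Q⋯P (inj₁ refl)        = P≢Q (≡-sym (branch-of-neighbour B~Q B~P Q⋯P))
            case-E _ Q⋯B (inj₂ (inj₁ refl)) = B∉branch Q⋯B
            case-E _ Q⋯S (inj₂ (inj₂ refl)) = S≢Q (≡-sym (branch-of-neighbour B~Q B~S Q⋯S))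

        d≁y : ¬ Adj G d y
        d≁y d~y = edge-clique d~y λ { (E , d∈E , y∈E) → case-E E d∈E (beyond-spread beyond-d d∈E) (y-cliques E y∈E) }
          where
            case-E : ∀ E → d ∈K E → Branch P E → E ≡ P ⊎ E ≡ B ⊎ E ≡ S → ⊥
            case-E _ d∈P _   (inj₁ refl)        = d∉P d∈P
            case-E _ _   P⋯B (inj₂ (inj₁ refl)) = B∉branch P⋯B
            case-E _ _   P⋯S (inj₂ (inj₂ refl)) = S≢P (≡-sym (branch-of-neighbour B~P B~S P⋯S))

    open Symmetries CT

    covered-twice : ∀ {A₁ A₂ A₃} → ForkTriangle CT B A₁ A₂ A₃ → ∀ {x} → x ∈K B →
                    (x ∈K A₁ × x ∈K A₂) ⊎ (x ∈K A₂ × x ∈K A₃) ⊎ (x ∈K A₃ × x ∈K A₁)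
    covered-twice (B~A₁ , B~A₂ , B~A₃ , A₁≢A₂ , A₂≢A₃ , A₁≢A₃ ,
                   (u , _ , u∈A₁ , u∈B , u∈A₂) , (v , _ , v∈A₂ , v∈B , v∈A₃) , (w , _ , w∈A₃ , w∈B , w∈A₁)) x∈B
      with pair-covers-B B~A₁ B~A₂ A₁≢A₂ u∈B u∈A₁ u∈A₂ x∈B
    ... | inj₁ x∈A₁ with pair-covers-B B~A₂ B~A₃ A₂≢A₃ v∈B v∈A₂ v∈A₃ x∈B
    ...   | inj₁ x∈A₂ = inj₁ (x∈A₁ , x∈A₂)
    ...   | inj₂ x∈A₃ = inj₂ (inj₂ (x∈A₃ , x∈A₁))
    covered-twice (B~A₁ , B~A₂ , B~A₃ , A₁≢A₂ , A₂≢A₃ , A₁≢A₃ , _ , _ , (w , _ , w∈A₃ , w∈B , w∈A₁)) x∈B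
        | inj₂ x∈A₂ with pair-covers-B B~A₃ B~A₁ (≢-sym A₁≢A₃) w∈B w∈A₃ w∈A₁ x∈B
    ...   | inj₁ x∈A₃ = inj₂ (inj₁ (x∈A₂ , x∈A₃))
    ...   | inj₂ x∈A₁ = inj₁ (x∈A₁ , x∈A₂)

    -- B has no neighbour besides a fork triangle: such a neighbour meets B (G is connected)
    -- in a vertex that would then lie in three neighbours of B
    fork-neighbours : Connected G → ∀ {A₁ A₂ A₃} → ForkTriangle CT B A₁ A₂ A₃ →
                      ∀ A → Nbr CT B A → A ≡ A₁ ⊎ A ≡ A₂ ⊎ A ≡ A₃
    fork-neighbours connected {A₁} {A₂} {A₃} fork@(B~A₁ , B~A₂ , B~A₃ , A₁≢A₂ , A₂≢A₃ , A₁≢A₃ , _) A B~A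
      with A ≟ A₁ | A ≟ A₂ | A ≟ A₃
    ... | yes A≡A₁ | _        | _        = inj₁ A≡A₁
    ... | no  _    | yes A≡A₂ | _        = inj₂ (inj₁ A≡A₂)
    ... | no  _    | no  _    | yes A≡A₃ = inj₂ (inj₂ A≡A₃)
    ... | no  A≢A₁ | no  A≢A₂ | no  A≢A₃ with neighbour-meets-B connected B~A
    ...   | x , x∈B , x∈A with covered-twice fork x∈B
    ...     | inj₁ (x∈A₁ , x∈A₂) =
      ⊥-elim (no-three-neighbours B~A₁ B~A₂ B~A A₁≢A₂ (≢-sym A≢A₂) (≢-sym A≢A₁) x∈B x∈A₁ x∈A₂ x∈A)
    ...     | inj₂ (inj₁ (x∈A₂ , x∈A₃)) =
      ⊥-elim (no-three-neighbours B~A₂ B~A₃ B~A A₂≢A₃ (≢-sym A≢A₃) (≢-sym A≢A₂) x∈B x∈A₂ x∈A₃ x∈A)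
    ...     | inj₂ (inj₂ (x∈A₃ , x∈A₁)) =
      ⊥-elim (no-three-neighbours B~A₃ B~A₁ B~A (≢-sym A₁≢A₃) (≢-sym A≢A₁) (≢-sym A≢A₃) x∈B x∈A₃ x∈A₁ x∈A)

    -- a vertex of B in two cliques of a fork triangle lies in no other max clique:
    -- its cliques beyond B are reached through a neighbour of B, i.e. a fork-triangle clique
    fork-pair-cliques : Connected G → ∀ {A₁ A₂ A₃} → ForkTriangle CT B A₁ A₂ A₃ →
                        ∀ {x} → x ∈K B → x ∈K A₁ → x ∈K A₂ → MEq CT x B A₁ A₂
    fork-pair-cliques connected {A₁} {A₂} {A₃}
                      fork@(B~A₁ , B~A₂ , B~A₃ , A₁≢A₂ , A₂≢A₃ , A₁≢A₃ , _ , (_ , v-cliques) , (_ , w-cliques))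
                      {x} x∈B x∈A₁ x∈A₂ = x-cliques , x∈B , x∈A₁ , x∈A₂
      where
        x-cliques : ∀ i → x ∈K i → i ≡ B ⊎ i ≡ A₁ ⊎ i ≡ A₂
        x-cliques i x∈i with i ≟ B | i ≟ A₁ | i ≟ A₂
        ... | yes i≡B | _        | _        = inj₁ i≡B
        ... | no  _   | yes i≡A₁ | _        = inj₂ (inj₁ i≡A₁)
        ... | no  _   | no  _    | yes i≡A₂ = inj₂ (inj₂ i≡A₂)
        ... | no  i≢B | no  i≢A₁ | no  i≢A₂ with exit-neighbour x∈B x∈i i≢B
        ...   | A , B~A , x∈A , A⋯i with fork-neighbours connected fork A B~A
        ...     | inj₁ refl =
          ⊥-elim (not-deeper B~A₁ B~A₂ B~A₃ A₁≢A₂ (≢-sym A₁≢A₃) (≢-sym A₂≢A₃) (meq-swap₁₃ w-cliques)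
                             x∈B x∈A₁ x∈A₂ x∈i A⋯i i≢A₁)
        ...     | inj₂ (inj₁ refl) =
          ⊥-elim (not-deeper B~A₂ B~A₁ B~A₃ (≢-sym A₁≢A₂) (≢-sym A₂≢A₃) (≢-sym A₁≢A₃) v-cliques
                             x∈B x∈A₂ x∈A₁ x∈i A⋯i i≢A₂)
        ...     | inj₂ (inj₂ refl) =
          ⊥-elim (no-three-neighbours B~A₁ B~A₂ B~A₃ A₁≢A₂ A₂≢A₃ A₁≢A₃ x∈B x∈A₁ x∈A₂ x∈A)

    fork-degree3 : Connected G → ∀ {A₁ A₂ A₃} → ForkTriangle CT B A₁ A₂ A₃ → Degree3 CT B
    fork-degree3 connected {A₁} {A₂} {A₃} fork@(B~A₁ , B~A₂ , B~A₃ , A₁≢A₂ , A₂≢A₃ , A₁≢A₃ , _) =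
      A₁ , A₂ , A₃ , B~A₁ , B~A₂ , B~A₃ , A₁≢A₂ , A₂≢A₃ , A₁≢A₃ , fork-neighbours connected fork

    fork-vertex-cliques : Connected G → ∀ {A₁ A₂ A₃} → ForkTriangle CT B A₁ A₂ A₃ →
                          ∀ x → x ∈K B → Σ Node λ A → Σ Node λ A′ →
                          Nbr CT B A × Nbr CT B A′ × A ≢ A′ × MEq CT x B A A′
    fork-vertex-cliques connected {A₁} {A₂} {A₃} fork@(B~A₁ , B~A₂ , B~A₃ , A₁≢A₂ , A₂≢A₃ , A₁≢A₃ , _) x x∈B
      with covered-twice fork x∈B
    ... | inj₁ (x∈A₁ , x∈A₂) =
      A₁ , A₂ , B~A₁ , B~A₂ , A₁≢A₂ , fork-pair-cliques connected fork x∈B x∈A₁ x∈A₂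
    ... | inj₂ (inj₁ (x∈A₂ , x∈A₃)) =
      A₂ , A₃ , B~A₂ , B~A₃ , A₂≢A₃ , fork-pair-cliques connected (rotate fork) x∈B x∈A₂ x∈A₃
    ... | inj₂ (inj₂ (x∈A₃ , x∈A₁)) =
      A₃ , A₁ , B~A₃ , B~A₁ , ≢-sym A₁≢A₃ , fork-pair-cliques connected (rotate (rotate fork)) x∈B x∈A₃ x∈A₁

    fork-witness : ∀ {A₁ A₂ A₃} → ForkTriangle CT B A₁ A₂ A₃ → ∃ λ v → v ∈K B × MEq CT v B A₁ A₂
    fork-witness (_ , _ , _ , _ , _ , _ , (u , u-cliques@(_ , _ , u∈B , _)) , _) = u , u∈B , meq-swap₁₂ u-cliques

    witness-flip : ∀ {a b} → (∃ λ v → v ∈K B × MEq CT v B a b) → ∃ λ v → v ∈K B × MEq CT v B b a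
    witness-flip (v , v∈B , v-cliques) = v , v∈B , meq-swap₂₃ v-cliques

    fork-pairs-witnessed : Connected G → ∀ {A₁ A₂ A₃} → ForkTriangle CT B A₁ A₂ A₃ →
                           ∀ A A′ → Nbr CT B A → Nbr CT B A′ → A ≢ A′ →
                           ∃ λ v → v ∈K B × MEq CT v B A A′
    fork-pairs-witnessed connected fork A A′ B~A B~A′ A≢A′
      with fork-neighbours connected fork A B~A | fork-neighbours connected fork A′ B~A′
    ... | inj₁ refl        | inj₁ refl        = ⊥-elim (A≢A′ refl)
    ... | inj₁ refl        | inj₂ (inj₁ refl) = fork-witness fork
    ... | inj₁ refl        | inj₂ (inj₂ refl) = witness-flip (fork-witness (rotate (rotate fork)))
    ... | inj₂ (inj₁ refl) | inj₁ refl        = witness-flip (fork-witness fork)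
    ... | inj₂ (inj₁ refl) | inj₂ (inj₁ refl) = ⊥-elim (A≢A′ refl)
    ... | inj₂ (inj₁ refl) | inj₂ (inj₂ refl) = fork-witness (rotate fork)
    ... | inj₂ (inj₂ refl) | inj₁ refl        = fork-witness (rotate (rotate fork))
    ... | inj₂ (inj₂ refl) | inj₂ (inj₁ refl) = witness-flip (fork-witness (rotate fork))
    ... | inj₂ (inj₂ refl) | inj₂ (inj₂ refl) = ⊥-elim (A≢A′ refl)

corollary3p13 : ∀ {n : ℕ} (G : Graph n) → Connected G → Chordal G → ClawFree G →
    (CT : CliqueTree G) → ∀ B → HasForkTriangle CT B → IsForkClique CT B
corollary3p13 G connected _ claw-free CT B (_ , _ , _ , fork) =
  fork-degree3 connected fork , fork-vertex-cliques connected fork , fork-pairs-witnessed connected fork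
  where
    open AroundClique CT B
    open ClawFreeAround claw-free
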